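{- Let $G=(V,E)$ be a finite simple undirected graph, $t\ge 0$ an integer and $u\in V$. For each $v\in V\setminus(\{u\}\cup N(u))$ let $S_v$ be the unique minimum-size important $(u,v)$-separator, let $V_0$ be the set of those such $v$ with $|S_v|\le t$, and for $v\in V_0$ let $R(v)=R(v,S_v)$. Then for any $v,w\in V_0$, if $w\in R(v)$ then $R(w)\subseteq R(v)$.
   Context: $N(U)=\bigcup_{x\in U}N(x)\setminus U$ for $U\subseteq V$. For disjoint $X,Y\subseteq V$, a set $S\subseteq V\setminus(X\cup Y)$ is an $(X,Y)$-separator if $G-S$ has no path from $X$ to $Y$; it is minimal if no proper subset is an $(X,Y)$-separator. For $S$ and $X\subseteq V\setminus S$, $R(X,S)$ is the set of vertices reachable from $X$ in $G-S$. An $(X,Y)$-separator $T$ dominates an $(X,Y)$-separator $S$ if $|T|\le|S|$ and $R(X,S)\subsetneq R(X,T)$; $S$ is important if it is minimal and no $(X,Y)$-separator dominates it. Singletons $\{x\}$ are written $x$. It is known that if an $(X,Y)$-separator exists, there is exactly one important $(X,Y)$-separator of minimum size. -}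

module Defs where

open import Data.Nat using (ℕ; _≤_)
open import Data.Fin using (Fin)
open import Data.Fin.Subset using (Subset; _∈_; _∉_; _⊆_; ⁅_⁆; ∣_∣)
open import Data.Product using (Σ; _×_; ∃)
open import Data.Empty using (⊥)
open import Relation.Nullary using (¬_)
open import Relation.Binary.PropositionalEquality using (_≡_)

record Graph (n : ℕ) : Set₁ where
  field
    Adj     : Fin n → Fin n → Set
    sym     : ∀ {x y} → Adj x y → Adj y x
    irrefl  : ∀ {x} → ¬ Adj x x
open Graph public

module _ {n : ℕ} (G : Graph n) where

  data Reach (S X : Subset n) : Fin n → Set where
    start : ∀ {x} → x ∈ X → x ∉ S → Reach S X x
    step  : ∀ {y z} → Reach S X y → Adj G y z → z ∉ S → Reach S X z

  IsSeparator : Subset n → Subset n → Subset n → Set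
  IsSeparator X Y S =
    (∀ {z} → z ∈ S → (z ∉ X) × (z ∉ Y)) ×
    (∀ {y} → y ∈ Y → ¬ Reach S X y)

  IsMinimalSeparator : Subset n → Subset n → Subset n → Set
  IsMinimalSeparator X Y S =
    IsSeparator X Y S ×
    (∀ S' → S' ⊆ S → IsSeparator X Y S' → S ⊆ S')

  ReachStrictSub : Subset n → Subset n → Subset n → Set
  ReachStrictSub X S T =
    (∀ {z} → Reach S X z → Reach T X z) × ∃ (λ z → Reach T X z × ¬ Reach S X z)

  Dominates : Subset n → Subset n → Subset n → Subset n → Set
  Dominates X Y T S = IsSeparator X Y T × ∣ T ∣ ≤ ∣ S ∣ × ReachStrictSub X S T

  IsImportant : Subset n → Subset n → Subset n → Set
  IsImportant X Y S =
    IsMinimalSeparator X Y S × (∀ T → ¬ Dominates X Y T S)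

  IsMinImportant : Subset n → Subset n → Subset n → Set
  IsMinImportant X Y S =
    IsImportant X Y S × (∀ T → IsImportant X Y T → ∣ S ∣ ≤ ∣ T ∣)

  NotClosedNbr : Fin n → Fin n → Set
  NotClosedNbr u v = ¬ (v ≡ u) × ¬ Adj G u v

-- Write R(S) for the vertices reachable from u in G − S. If w lies beyond Sv, then R(Sv) ⊆ R(Sw):
-- otherwise uncrossing Sv and Sw yields a (u,v)-separator I and a (u,w)-separator U with
-- |U| + |I| ≤ |Sv| + |Sw|; since Sv is a smallest (u,v)-separator, |U| ≤ |Sw|, and U dominates Sw.
-- Hence no vertex of Sv is reachable from w in G − Sw (it has a neighbour in R(Sv) ⊆ R(Sw), which
-- would connect u to w), so walks from w avoiding Sw also avoid Sv.
-- Adjacency is not decidable, so the argument runs in the double-negation monad, where the least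
-- number principle supplies reach sets as subsets and extremal separators.
module Submission where

open import Defs hiding (sym)
open import Data.Nat using (ℕ; suc; _+_; _∸_; _≤_; _<_; _≤?_)
open import Data.Nat.Properties
  using (≤-refl; ≤-trans; <-≤-trans; <⇒≱; ≰⇒>; m∸n≤m; ∸-monoʳ-<; +-suc; +-mono-≤; +-monoˡ-≤; +-comm; +-cancelʳ-≤; module ≤-Reasoning)
open import Data.Nat.Induction using (<-rec)
open import Data.Fin using (Fin; _≟_)
open import Data.Fin.Subset using (Subset; _∈_; _∉_; _⊆_; ⁅_⁆; ∣_∣; _∪_; _∩_; ∁; _-_; Lift; inside; outside)
  renaming (⊥ to ∅)
open import Data.Fin.Subset.Properties
  using ( _∈?_; ∉⊥; x∈⁅x⁆; x∈⁅y⁆⇒x≡y; x∈p∪q⁺; x∈p∪q⁻; x∈p∩q⁺; x∈p∩q⁻; x∈∁p⇒x∉p; x∉p⇒x∈∁p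
        ; p⊆p∪q; p∩q⊆p; p─q⊆p; x∈p⇒p-x⊂p; x∈p∧x≢y⇒x∈p-y; p⊆q⇒∣p∣≤∣q∣; p⊂q⇒∣p∣<∣q∣; ∣p∣≤n )
open import Data.Vec using ([]; _∷_)
open import Data.Product using (∃; ∃₂; _×_; _,_; proj₁; proj₂)
open import Data.Sum using (_⊎_; inj₁; inj₂)
import Data.Sum as Sum
open import Effect.Monad using (RawMonad)
open import Level using (0ℓ)
open import Relation.Nullary using (¬_; yes; no; contradiction)
open import Relation.Nullary.Decidable using (decidable-stable)
open import Relation.Nullary.Negation using (¬¬-Monad)
open import Relation.Binary.PropositionalEquality using (_≡_; refl; cong; sym; trans; subst)
open import Function.Base using (_∘_)
open import Function.Bundles using (_⇔_; mk⇔; Equivalence)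

open RawMonad (¬¬-Monad {0ℓ})
open Equivalence using (to; from)

¬¬-least : ∀ {P : ℕ → Set} {k} → P k → ¬ ¬ (∃ λ m → P m × ∀ {j} → P j → m ≤ j)
¬¬-least {P} {k} Pk noLeast = <-rec (λ m → ¬ P m) notBelow k Pk
  where
  notBelow : ∀ m → (∀ {j} → j < m → ¬ P j) → ¬ P m
  notBelow m below Pm = noLeast (m , Pm , least)
    where
    least : ∀ {j} → P j → m ≤ j
    least {j} Pj with m ≤? j
    ... | yes m≤j = m≤j
    ... | no  m≰j = contradiction Pj (below (≰⇒> m≰j))

n∸∣p∪⁅x⁆∣<n∸∣p∣ : ∀ {n} {p : Subset n} {x} → x ∉ p → n ∸ ∣ p ∪ ⁅ x ⁆ ∣ < n ∸ ∣ p ∣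
n∸∣p∪⁅x⁆∣<n∸∣p∣ {p = p} {x} x∉p =
  ∸-monoʳ-< (p⊂q⇒∣p∣<∣q∣ (p⊆p∪q ⁅ x ⁆ , x , x∈p∪q⁺ (inj₂ (x∈⁅x⁆ x)) , x∉p)) (∣p∣≤n (p ∪ ⁅ x ⁆))

Lift-∪⁅⁆ : ∀ {n} {P : Fin n → Set} {p x} → Lift P p → P x → Lift P (p ∪ ⁅ x ⁆)
Lift-∪⁅⁆ {p = p} {x} Pp Px y∈ with x∈p∪q⁻ p ⁅ x ⁆ y∈
... | inj₁ y∈p = Pp y∈p
... | inj₂ y∈x rewrite x∈⁅y⁆⇒x≡y x y∈x = Px

¬¬-comprehension : ∀ {n} (P : Fin n → Set) → ¬ ¬ (∃ λ r → ∀ {x} → x ∈ r ⇔ P x)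
¬¬-comprehension {n} P = do
  _ , (r , r⊆P , r-bound) , least ← ¬¬-least {Below} (∅ , (λ x∈∅ → contradiction x∈∅ ∉⊥) , m∸n≤m n ∣ ∅ {n} ∣)
  return (r , λ {x} → mk⇔ r⊆P (P⊆r r⊆P r-bound least))
  where
  Below : ℕ → Set
  Below d = ∃ λ r → Lift P r × n ∸ ∣ r ∣ ≤ d

  P⊆r : ∀ {d r} → Lift P r → n ∸ ∣ r ∣ ≤ d → (∀ {j} → Below j → d ≤ j) → ∀ {x} → P x → x ∈ r
  P⊆r {r = r} r⊆P r-bound least {x} Px with x ∈? r
  ... | yes x∈r = x∈r
  ... | no  x∉r = contradiction (least (r ∪ ⁅ x ⁆ , Lift-∪⁅⁆ r⊆P Px , ≤-refl))
                    (<⇒≱ (<-≤-trans (n∸∣p∪⁅x⁆∣<n∸∣p∣ x∉r) r-bound))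

∣p∪q∣+∣p∩q∣≡∣p∣+∣q∣ : ∀ {n} (p q : Subset n) → ∣ p ∪ q ∣ + ∣ p ∩ q ∣ ≡ ∣ p ∣ + ∣ q ∣
∣p∪q∣+∣p∩q∣≡∣p∣+∣q∣ []            []            = refl
∣p∪q∣+∣p∩q∣≡∣p∣+∣q∣ (inside  ∷ p) (inside  ∷ q) =
  cong suc (trans (+-suc _ _) (trans (cong suc (∣p∪q∣+∣p∩q∣≡∣p∣+∣q∣ p q)) (sym (+-suc _ _))))
∣p∪q∣+∣p∩q∣≡∣p∣+∣q∣ (inside  ∷ p) (outside ∷ q) = cong suc (∣p∪q∣+∣p∩q∣≡∣p∣+∣q∣ p q)
∣p∪q∣+∣p∩q∣≡∣p∣+∣q∣ (outside ∷ p) (inside  ∷ q) =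
  trans (cong suc (∣p∪q∣+∣p∩q∣≡∣p∣+∣q∣ p q)) (sym (+-suc _ _))
∣p∪q∣+∣p∩q∣≡∣p∣+∣q∣ (outside ∷ p) (outside ∷ q) = ∣p∪q∣+∣p∩q∣≡∣p∣+∣q∣ p q

∣p∣+∣q∣≤∣r∣+∣s∣ : ∀ {n} {p q r s : Subset n} → p ∩ q ⊆ r ∩ s → p ∪ q ⊆ r ∪ s →
                 ∣ p ∣ + ∣ q ∣ ≤ ∣ r ∣ + ∣ s ∣
∣p∣+∣q∣≤∣r∣+∣s∣ {p = p} {q} {r} {s} ∩⊆∩ ∪⊆∪ = begin
  ∣ p ∣ + ∣ q ∣             ≡⟨ sym (∣p∪q∣+∣p∩q∣≡∣p∣+∣q∣ p q) ⟩
  ∣ p ∪ q ∣ + ∣ p ∩ q ∣     ≤⟨ +-mono-≤ (p⊆q⇒∣p∣≤∣q∣ ∪⊆∪) (p⊆q⇒∣p∣≤∣q∣ ∩⊆∩) ⟩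
  ∣ r ∪ s ∣ + ∣ r ∩ s ∣     ≡⟨ ∣p∪q∣+∣p∩q∣≡∣p∣+∣q∣ r s ⟩
  ∣ r ∣ + ∣ s ∣             ∎
  where open ≤-Reasoning

module Separators {n} (G : Graph n) where

  Reach⇒∉ : ∀ {S X z} → Reach G S X z → z ∉ S
  Reach⇒∉ (start _ z∉S)  = z∉S
  Reach⇒∉ (step _ _ z∉S) = z∉S

  Reach-least : ∀ {S X} {A : Fin n → Set} →
                (∀ {x} → x ∈ X → x ∉ S → A x) →
                (∀ {y z} → A y → Adj G y z → z ∉ S → A z) →
                ∀ {z} → Reach G S X z → A z
  Reach-least base closed (start x∈X x∉S)  = base x∈X x∉S
  Reach-least base closed (step r adj z∉S) = closed (Reach-least base closed r) adj z∉S

  Reach-mono : ∀ {S T X} → (∀ {z} → Reach G S X z → z ∉ T) →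
               ∀ {z} → Reach G S X z → Reach G T X z
  Reach-mono avoids r@(start x∈X _)  = start x∈X (avoids r)
  Reach-mono avoids r@(step r′ adj _) = step (Reach-mono avoids r′) adj (avoids r)

  Reach-trans : ∀ {S X a b} → Reach G S X a → Reach G S ⁅ a ⁆ b → Reach G S X b
  Reach-trans {S} {X} {a} a∈R = Reach-least (λ x∈a _ → subst (Reach G S X) (sym (x∈⁅y⁆⇒x≡y a x∈a)) a∈R) step

  Reach-sym : ∀ {S a b} → Reach G S ⁅ a ⁆ b → Reach G S ⁅ b ⁆ a
  Reach-sym {S} {a} (start {x} x∈a x∉S) = subst (Reach G S ⁅ x ⁆) (x∈⁅y⁆⇒x≡y a x∈a) (start (x∈⁅x⁆ x) x∉S)
  Reach-sym (step {z = z} r adj z∉S) =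
    Reach-trans (step (start (x∈⁅x⁆ z) z∉S) (Graph.sym G adj) (Reach⇒∉ r)) (Reach-sym r)

  -- Otherwise S - s would already separate.
  minimal⇒reached-neighbour : ∀ {X Y S s} → IsMinimalSeparator G X Y S → s ∈ S →
                              ¬ ¬ (∃ λ a → Reach G S X a × Adj G a s)
  minimal⇒reached-neighbour {X} {Y} {S} {s} (sepS , minimal) s∈S noNeighbour
    with x∈p⇒p-x⊂p s∈S
  ... | _ , x , x∈S , x∉S-s = x∉S-s (minimal (S - s) (p─q⊆p S ⁅ s ⁆) sepS-s x∈S)
    where
    reachS : ∀ {y} → Reach G (S - s) X y → Reach G S X y
    reachS = Reach-least (λ x∈X _ → start x∈X (λ x∈S → proj₁ (proj₁ sepS x∈S) x∈X)) closed
      where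
      closed : ∀ {y z} → Reach G S X y → Adj G y z → z ∉ S - s → Reach G S X z
      closed {y} {z} r adj z∉S-s with z ∈? S | z ≟ s
      ... | no z∉S | _       = step r adj z∉S
      ... | yes _  | yes refl = contradiction (y , r , adj) noNeighbour
      ... | yes z∈S | no z≢s = contradiction (x∈p∧x≢y⇒x∈p-y z∈S z≢s) z∉S-s
    sepS-s : IsSeparator G X Y (S - s)
    sepS-s = (λ z∈S-s → proj₁ sepS (p─q⊆p S ⁅ s ⁆ z∈S-s)) , (λ y∈Y r → proj₂ sepS y∈Y (reachS r))

  -- Among separators of least size, take one whose reach contains a largest possible set r:
  -- it is minimal by the first choice, and a dominating separator would extend r by one vertex.
  separator⇒important-below : ∀ {X Y T} → IsSeparator G X Y T →
                              ¬ ¬ (∃ λ T′ → IsImportant G X Y T′ × ∣ T′ ∣ ≤ ∣ T ∣)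
  separator⇒important-below {X} {Y} {T} sepT = do
    k , (T₁ , sep₁ , T₁≤k) , k-least ← ¬¬-least {SizeBelow} (T , sepT , ≤-refl)
    _ , (T₂ , r , sep₂ , T₂≤k , r⊆R , r-bound) , d-least ←
      ¬¬-least {ReachAbove k} (T₁ , ∅ , sep₁ , T₁≤k , (λ x∈∅ → contradiction x∈∅ ∉⊥) , m∸n≤m n ∣ ∅ {n} ∣)
    return ( T₂
           , ((sep₂ , minimal k-least T₂≤k) , undominated d-least T₂≤k r⊆R r-bound)
           , ≤-trans T₂≤k (k-least (T , sepT , ≤-refl)) )
    where
    SizeBelow : ℕ → Set
    SizeBelow k = ∃ λ T′ → IsSeparator G X Y T′ × ∣ T′ ∣ ≤ k

    ReachAbove : ℕ → ℕ → Set
    ReachAbove k d = ∃₂ λ T′ r → IsSeparator G X Y T′ × ∣ T′ ∣ ≤ k × Lift (Reach G T′ X) r × n ∸ ∣ r ∣ ≤ d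

    minimal : ∀ {k T₂} → (∀ {j} → SizeBelow j → k ≤ j) → ∣ T₂ ∣ ≤ k →
              ∀ S′ → S′ ⊆ T₂ → IsSeparator G X Y S′ → T₂ ⊆ S′
    minimal k-least T₂≤k S′ S′⊆T₂ sepS′ {x} x∈T₂ with x ∈? S′
    ... | yes x∈S′ = x∈S′
    ... | no  x∉S′ = contradiction (k-least (S′ , sepS′ , ≤-refl))
                       (<⇒≱ (<-≤-trans (p⊂q⇒∣p∣<∣q∣ (S′⊆T₂ , x , x∈T₂ , x∉S′)) T₂≤k))

    undominated : ∀ {k d T₂ r} → (∀ {j} → ReachAbove k j → d ≤ j) → ∣ T₂ ∣ ≤ k →
                  Lift (Reach G T₂ X) r → n ∸ ∣ r ∣ ≤ d → ∀ T′ → ¬ Dominates G X Y T′ T₂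
    undominated {r = r} d-least T₂≤k r⊆R r-bound T′ (sep′ , T′≤T₂ , (R⊆R′ , z , z∈R′ , z∉R)) =
      contradiction (d-least (T′ , r ∪ ⁅ z ⁆ , sep′ , ≤-trans T′≤T₂ T₂≤k , r∪z⊆R′ , ≤-refl))
        (<⇒≱ (<-≤-trans (n∸∣p∪⁅x⁆∣<n∸∣p∣ (λ z∈r → z∉R (r⊆R z∈r))) r-bound))
      where
      r∪z⊆R′ : Lift (Reach G T′ X) (r ∪ ⁅ z ⁆)
      r∪z⊆R′ = Lift-∪⁅⁆ (λ x∈r → R⊆R′ (r⊆R x∈r)) z∈R′

  IsMinImportant⇒minimum : ∀ {X Y S T} → IsMinImportant G X Y S → IsSeparator G X Y T → ∣ S ∣ ≤ ∣ T ∣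
  IsMinImportant⇒minimum {S = S} {T} (_ , S-least) sepT = decidable-stable (∣ S ∣ ≤? ∣ T ∣) do
    T′ , impT′ , T′≤T ← separator⇒important-below sepT
    return (≤-trans (S-least T′ impT′) T′≤T)

  -- U and I enclose A ∪ B and A ∩ B; every vertex of S and T is counted in U or I, and in both
  -- only if it lies in S ∩ T.
  module Uncrossing {X Y Z S T A B : Subset n}
    (sepS : IsSeparator G X Y S) (sepT : IsSeparator G X Z T)
    (A⇔ : ∀ {x} → x ∈ A ⇔ Reach G S X x) (B⇔ : ∀ {x} → x ∈ B ⇔ Reach G T X x)
    (Z∉S : ∀ {z} → z ∈ Z → z ∉ S) (Z-unreached : ∀ {z} → z ∈ Z → ¬ Reach G S X z)
    where

    U : Subset n
    U = (S ∪ T) ∩ ∁ (A ∪ B)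

    I : Subset n
    I = (S ∩ T) ∪ ((S ∩ B) ∪ (T ∩ A))

    X∉S : ∀ {x} → x ∈ X → x ∉ S
    X∉S x∈X x∈S = proj₁ (proj₁ sepS x∈S) x∈X

    X∉T : ∀ {x} → x ∈ X → x ∉ T
    X∉T x∈X x∈T = proj₁ (proj₁ sepT x∈T) x∈X

    ∈U⁺ : ∀ {x} → x ∈ S ⊎ x ∈ T → x ∉ A ∪ B → x ∈ U
    ∈U⁺ x∈S∪T x∉A∪B = x∈p∩q⁺ (x∈p∪q⁺ x∈S∪T , x∉p⇒x∈∁p x∉A∪B)

    ∈U⁻ : ∀ {x} → x ∈ U → (x ∈ S ⊎ x ∈ T) × x ∉ A ∪ B
    ∈U⁻ x∈U with x∈p∩q⁻ (S ∪ T) _ x∈U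
    ... | x∈S∪T , x∈∁A∪B = x∈p∪q⁻ S T x∈S∪T , x∈∁p⇒x∉p x∈∁A∪B

    ∈I⁻ : ∀ {x} → x ∈ I → (x ∈ S × x ∈ T) ⊎ (x ∈ S × x ∈ B) ⊎ (x ∈ T × x ∈ A)
    ∈I⁻ x∈I with x∈p∪q⁻ (S ∩ T) _ x∈I
    ... | inj₁ x∈S∩T = inj₁ (x∈p∩q⁻ S T x∈S∩T)
    ... | inj₂ x∈rest with x∈p∪q⁻ (S ∩ B) _ x∈rest
    ...   | inj₁ x∈S∩B = inj₂ (inj₁ (x∈p∩q⁻ S B x∈S∩B))
    ...   | inj₂ x∈T∩A = inj₂ (inj₂ (x∈p∩q⁻ T A x∈T∩A))

    reached∉U : ∀ {x} → Reach G S X x ⊎ Reach G T X x → x ∉ U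
    reached∉U r x∈U = proj₂ (∈U⁻ x∈U) (x∈p∪q⁺ (Sum.map (from A⇔) (from B⇔) r))

    U-reach : ∀ {y} → Reach G U X y → Reach G S X y ⊎ Reach G T X y
    U-reach = Reach-least (λ x∈X _ → inj₁ (start x∈X (X∉S x∈X))) closed
      where
      leaving : ∀ {z} → z ∈ S ⊎ z ∈ T → z ∉ U → Reach G S X z ⊎ Reach G T X z
      leaving {z} z∈S∪T z∉U with z ∈? (A ∪ B)
      ... | yes z∈A∪B = Sum.map (to A⇔) (to B⇔) (x∈p∪q⁻ A B z∈A∪B)
      ... | no  z∉A∪B = contradiction (∈U⁺ z∈S∪T z∉A∪B) z∉U
      closed : ∀ {y z} → Reach G S X y ⊎ Reach G T X y → Adj G y z → z ∉ U →
               Reach G S X z ⊎ Reach G T X z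
      closed {z = z} (inj₁ r) adj z∉U with z ∈? S
      ... | yes z∈S = leaving (inj₁ z∈S) z∉U
      ... | no  z∉S = inj₁ (step r adj z∉S)
      closed {z = z} (inj₂ r) adj z∉U with z ∈? T
      ... | yes z∈T = leaving (inj₂ z∈T) z∉U
      ... | no  z∉T = inj₂ (step r adj z∉T)

    I-reach : ∀ {y} → Reach G I X y → Reach G S X y × Reach G T X y
    I-reach = Reach-least (λ x∈X _ → start x∈X (X∉S x∈X) , start x∈X (X∉T x∈X)) closed
      where
      closed : ∀ {y z} → Reach G S X y × Reach G T X y → Adj G y z → z ∉ I →
               Reach G S X z × Reach G T X z
      closed {z = z} (rS , rT) adj z∉I with z ∈? S | z ∈? T
      ... | no  z∉S | no  z∉T = step rS adj z∉S , step rT adj z∉T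
      ... | yes z∈S | yes z∈T = contradiction (x∈p∪q⁺ (inj₁ (x∈p∩q⁺ (z∈S , z∈T)))) z∉I
      ... | yes z∈S | no  z∉T =
        contradiction (x∈p∪q⁺ (inj₂ (x∈p∪q⁺ (inj₁ (x∈p∩q⁺ (z∈S , from B⇔ (step rT adj z∉T))))))) z∉I
      ... | no  z∉S | yes z∈T =
        contradiction (x∈p∪q⁺ (inj₂ (x∈p∪q⁺ (inj₂ (x∈p∩q⁺ (z∈T , from A⇔ (step rS adj z∉S))))))) z∉I

    U-separates : IsSeparator G X Z U
    U-separates = outside-XZ , λ z∈Z r → Sum.[ Z-unreached z∈Z , proj₂ sepT z∈Z ] (U-reach r)
      where
      outside-XZ : ∀ {x} → x ∈ U → x ∉ X × x ∉ Z
      outside-XZ x∈U with proj₁ (∈U⁻ x∈U)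
      ... | inj₁ x∈S = (λ x∈X → X∉S x∈X x∈S) , (λ x∈Z → Z∉S x∈Z x∈S)
      ... | inj₂ x∈T = proj₁ sepT x∈T

    I-separates : IsSeparator G X Y I
    I-separates = outside-XY , λ y∈Y r → proj₂ sepS y∈Y (proj₁ (I-reach r))
      where
      outside-XY : ∀ {x} → x ∈ I → x ∉ X × x ∉ Y
      outside-XY x∈I with ∈I⁻ x∈I
      ... | inj₁ (x∈S , _)        = proj₁ sepS x∈S
      ... | inj₂ (inj₁ (x∈S , _)) = proj₁ sepS x∈S
      ... | inj₂ (inj₂ (x∈T , x∈A)) = (λ x∈X → X∉T x∈X x∈T) , (λ x∈Y → proj₂ sepS x∈Y (to A⇔ x∈A))

    ∣U∣+∣I∣≤∣S∣+∣T∣ : ∣ U ∣ + ∣ I ∣ ≤ ∣ S ∣ + ∣ T ∣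
    ∣U∣+∣I∣≤∣S∣+∣T∣ = ∣p∣+∣q∣≤∣r∣+∣s∣ U∩I⊆S∩T U∪I⊆S∪T
      where
      U∩I⊆S∩T : U ∩ I ⊆ S ∩ T
      U∩I⊆S∩T x∈U∩I with x∈p∩q⁻ U I x∈U∩I
      ... | x∈U , x∈I with ∈I⁻ x∈I
      ...   | inj₁ x∈S∩T               = x∈p∩q⁺ x∈S∩T
      ...   | inj₂ (inj₁ (_ , x∈B))    = contradiction (x∈p∪q⁺ (inj₂ x∈B)) (proj₂ (∈U⁻ x∈U))
      ...   | inj₂ (inj₂ (_ , x∈A))    = contradiction (x∈p∪q⁺ (inj₁ x∈A)) (proj₂ (∈U⁻ x∈U))
      U∪I⊆S∪T : U ∪ I ⊆ S ∪ T
      U∪I⊆S∪T x∈U∪I with x∈p∪q⁻ U I x∈U∪I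
      ... | inj₁ x∈U = p∩q⊆p (S ∪ T) _ x∈U
      ... | inj₂ x∈I with ∈I⁻ x∈I
      ...   | inj₁ (x∈S , _)          = x∈p∪q⁺ (inj₁ x∈S)
      ...   | inj₂ (inj₁ (x∈S , _))   = x∈p∪q⁺ (inj₁ x∈S)
      ...   | inj₂ (inj₂ (x∈T , _))   = x∈p∪q⁺ (inj₂ x∈T)

    U-dominates : ∣ S ∣ ≤ ∣ I ∣ → ∀ {a} → Reach G S X a → ¬ Reach G T X a → Dominates G X Z U T
    U-dominates S≤I a∈RS a∉RT =
      U-separates , ∣U∣≤∣T∣ , (Reach-mono (reached∉U ∘ inj₂) , _ , Reach-mono (reached∉U ∘ inj₁) a∈RS , a∉RT)
      where
      ∣U∣≤∣T∣ : ∣ U ∣ ≤ ∣ T ∣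
      ∣U∣≤∣T∣ = +-cancelʳ-≤ (∣ I ∣) (∣ U ∣) (∣ T ∣) (begin
        ∣ U ∣ + ∣ I ∣ ≤⟨ ∣U∣+∣I∣≤∣S∣+∣T∣ ⟩
        ∣ S ∣ + ∣ T ∣ ≤⟨ +-monoˡ-≤ (∣ T ∣) S≤I ⟩
        ∣ I ∣ + ∣ T ∣ ≡⟨ +-comm (∣ I ∣) (∣ T ∣) ⟩
        ∣ T ∣ + ∣ I ∣ ∎)
        where open ≤-Reasoning

  minImportant-reach⊆important-reach :
    ∀ {X Y Z S T} → IsMinImportant G X Y S → IsImportant G X Z T →
    (∀ {z} → z ∈ Z → z ∉ S) → (∀ {z} → z ∈ Z → ¬ Reach G S X z) →
    ∀ {a} → Reach G S X a → ¬ ¬ Reach G T X a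
  minImportant-reach⊆important-reach {X} {S = S} {T} minS impT Z∉S Z-unreached a∈RS a∉RT =
    ¬¬-comprehension (Reach G S X) λ (A , A⇔) →
    ¬¬-comprehension (Reach G T X) λ (B , B⇔) →
    let open Uncrossing (proj₁ (proj₁ (proj₁ minS))) (proj₁ (proj₁ impT)) A⇔ B⇔ Z∉S Z-unreached in
    proj₂ impT U (U-dominates (IsMinImportant⇒minimum minS I-separates) a∈RS a∉RT)

-- The bound t and v, w ∉ N[u] only delimit V₀; the inclusion holds without them.
lemma3 : ∀ {n : ℕ} (G : Graph n) (t : ℕ) (u v w : Fin n)
         (Sv Sw : Subset n) →
         NotClosedNbr G u v → IsMinImportant G ⁅ u ⁆ ⁅ v ⁆ Sv → ∣ Sv ∣ ≤ t →
         NotClosedNbr G u w → IsMinImportant G ⁅ u ⁆ ⁅ w ⁆ Sw → ∣ Sw ∣ ≤ t →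
         Reach G Sv ⁅ v ⁆ w →
         ∀ z → Reach G Sw ⁅ w ⁆ z → Reach G Sv ⁅ v ⁆ z
lemma3 G t u v w Sv Sw _ minSv _ _ minSw _ v⇝w _ w⇝z = proj₂ (Reach-least base closed w⇝z)
  where
  open Separators G
  sepSv : IsSeparator G ⁅ u ⁆ ⁅ v ⁆ Sv
  sepSv = proj₁ (proj₁ (proj₁ minSv))
  sepSw : IsSeparator G ⁅ u ⁆ ⁅ w ⁆ Sw
  sepSw = proj₁ (proj₁ (proj₁ minSw))

  w-beyond-Sv : ∀ {x} → x ∈ ⁅ w ⁆ → x ∉ Sv × ¬ Reach G Sv ⁅ u ⁆ x
  w-beyond-Sv x∈w rewrite x∈⁅y⁆⇒x≡y w x∈w =
    Reach⇒∉ v⇝w , λ u⇝w → proj₂ sepSv (x∈⁅x⁆ v) (Reach-trans u⇝w (Reach-sym v⇝w))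

  Sv∩Rw=∅ : ∀ {x} → x ∈ Sv → ¬ Reach G Sw ⁅ w ⁆ x
  Sv∩Rw=∅ x∈Sv w⇝x = minimal⇒reached-neighbour (proj₁ (proj₁ minSv)) x∈Sv λ (a , u⇝a , a~x) →
    minImportant-reach⊆important-reach minSv (proj₁ minSw)
      (proj₁ ∘ w-beyond-Sv) (proj₂ ∘ w-beyond-Sv) u⇝a λ u⇝a′ →
    proj₂ sepSw (x∈⁅x⁆ w) (Reach-trans (step u⇝a′ a~x (Reach⇒∉ w⇝x)) (Reach-sym w⇝x))

  base : ∀ {x} → x ∈ ⁅ w ⁆ → x ∉ Sw → Reach G Sw ⁅ w ⁆ x × Reach G Sv ⁅ v ⁆ x
  base x∈w x∉Sw rewrite x∈⁅y⁆⇒x≡y w x∈w = start (x∈⁅x⁆ w) x∉Sw , v⇝w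

  closed : ∀ {y x} → Reach G Sw ⁅ w ⁆ y × Reach G Sv ⁅ v ⁆ y → Adj G y x → x ∉ Sw →
           Reach G Sw ⁅ w ⁆ x × Reach G Sv ⁅ v ⁆ x
  closed {x = x} (w⇝y , v⇝y) y~x x∉Sw with x ∈? Sv
  ... | yes x∈Sv = contradiction (step w⇝y y~x x∉Sw) (Sv∩Rw=∅ x∈Sv)
  ... | no  x∉Sv = step w⇝y y~x x∉Sw , step v⇝y y~x x∉Sv
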